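{- Let $n\ge k\ge1$ and let $\mathcal{F}\subseteq\binom{[n]}{k}\cup\binom{[n]}{k-1}$ be s-extremal. Then $\mathcal{F}$ has Vapnik–Chervonenkis dimension at most $1$.
   Context: $[n]=\{1,\dots,n\}$ and $\binom{[n]}{k}$ is the family of $k$-element subsets of $[n]$. A family $\mathcal{F}\subseteq 2^{[n]}$ shatters $S\subseteq[n]$ if $\{F\cap S: F\in\mathcal{F}\}=2^S$; $Sh(\mathcal{F})$ is the family of all sets shattered by $\mathcal{F}$; $\mathcal{F}$ is s-extremal if $|Sh(\mathcal{F})|=|\mathcal{F}|$. The Vapnik–Chervonenkis dimension of $\mathcal{F}$ is the maximum size of a set shattered by $\mathcal{F}$. -}

module Defs where

open import Data.Nat using (ℕ; suc; _≤_)
open import Data.Fin.Subset using (Subset; _∩_; _⊆_; ∣_∣)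
open import Data.List using (List; length)
open import Data.List.Membership.Propositional using (_∈_)
open import Data.List.Relation.Unary.Unique.Propositional using (Unique)
open import Data.Product using (Σ; ∃; _×_; _,_)
open import Data.Sum using (_⊎_)
open import Relation.Binary.PropositionalEquality using (_≡_)

record Family (n : ℕ) : Set where
  constructor family
  field
    members : List (Subset n)
    distinct : Unique members
open Family public

card : ∀ {n} → Family n → ℕ
card 𝓕 = length (members 𝓕)

-- 𝓕 shatters S : {F ∩ S : F ∈ 𝓕} = 2^S, i.e. every T ⊆ S is F ∩ S for some F ∈ 𝓕
-- (the inclusion F ∩ S ⊆ S is automatic).
Shatters : ∀ {n} → Family n → Subset n → Set
Shatters 𝓕 S = ∀ T → T ⊆ S → ∃ λ F → F ∈ members 𝓕 × F ∩ S ≡ T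

Enumerates-Sh : ∀ {n} → Family n → List (Subset n) → Set
Enumerates-Sh 𝓕 L = Unique L × (∀ S → (S ∈ L → Shatters 𝓕 S) × (Shatters 𝓕 S → S ∈ L))

SExtremal : ∀ {n} → Family n → Set
SExtremal 𝓕 = ∃ λ L → Enumerates-Sh 𝓕 L × length L ≡ card 𝓕

VCdim≤ : ∀ {n} → Family n → ℕ → Set
VCdim≤ 𝓕 d = ∀ S → Shatters 𝓕 S → ∣ S ∣ ≤ d

-- 𝓕 ⊆ binom([n],k) ∪ binom([n],k-1)  (|F| = k or |F| = k - 1, the latter as suc |F| = k)
InTwoLayers : ∀ {n} → Family n → ℕ → Set
InTwoLayers 𝓕 k = ∀ F → F ∈ members 𝓕 → (∣ F ∣ ≡ k) ⊎ (suc ∣ F ∣ ≡ k)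

module Submission where

-- Proof idea (Bollobás–Radcliffe, via Pajor's lemma).  Identify a family on
-- [n] with its characteristic function f : Subset n → Bool.  Besides the
-- shattered sets Sh(f) we use the strongly traced sets: S is strongly traced
-- if some T disjoint from S has T ∪ S' ∈ f for every S' ⊆ S.  Both notions
-- are computed by recursion on n through the two sections of f along the
-- first coordinate.  Pajor's lemma |f| ≤ |Sh(f)| is proved in the sharpened
-- form  |f| + [S shattered but not strongly traced] ≤ |Sh(f)|,  by induction
-- on n using the modular law |g ∪ h| + |g ∩ h| = |g| + |h|.  Hence in an
-- s-extremal family every shattered set S is strongly traced, so T and T ∪ S
-- both lie in the family for some T disjoint from S.  If all members have
-- size k or k - 1, this forces |T| + |S| ≤ |T| + 1, i.e. |S| ≤ 1.
-- The file develops, in order: families as Boolean functions and their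
-- counts; Sh, strong traces and the sharpened Pajor lemma; the link with the
-- list-based notions of Defs (shattering, enumerations, membership); and
-- finally the theorem.

open import Defs
open import Data.Bool using (Bool; true; false; _∧_; _∨_; not; if_then_else_)
open import Data.Bool.Properties using (∧-conicalˡ; ∧-conicalʳ; ∨-zeroʳ) renaming (_≟_ to _≟ᵇ_)
open import Data.Nat using (ℕ; zero; suc; _+_; _≤_; z≤n; s≤s)
open import Data.Nat.Properties using (≤-refl; ≤-trans; m≤m+n; n≤1+n; +-mono-≤; +-monoˡ-≤; +-monoʳ-≤; +-assoc; +-suc; +-comm; +-cancelˡ-≤; m+1+n≰m; module ≤-Reasoning)
open import Data.Nat.Tactic.RingSolver using (solve-∀)
open import Data.Vec using ([]; _∷_; here)
open import Data.Vec.Properties using (∷-injectiveʳ; ≡-dec)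
open import Data.Fin.Subset using (Subset; outside; inside; _∩_; _∪_; _⊆_; ∣_∣)
open import Data.Fin.Subset.Properties using (out⊆; in⊆in; drop-∷-⊆)
open import Data.List using (List; []; _∷_; _++_; map; length)
open import Data.List.Properties using (length-++; length-map)
open import Data.List.Membership.Propositional using (_∈_)
open import Data.List.Membership.Propositional.Properties using (∈-map⁺; ∈-map⁻; ∈-++⁺ˡ; ∈-++⁺ʳ; ∈-++⁻)
open import Data.List.Membership.Propositional.Properties.WithK using (unique∧set⇒bag)
import Data.List.Membership.DecPropositional as DecMembership
open import Data.List.Relation.Unary.Any using (here)
import Data.List.Relation.Unary.All as All
open import Data.List.Relation.Unary.AllPairs using ([]; _∷_)
open import Data.List.Relation.Unary.Unique.Propositional using (Unique)
open import Data.List.Relation.Unary.Unique.Propositional.Properties using (map⁺; ++⁺)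
open import Data.List.Relation.Binary.BagAndSetEquality using (∼bag⇒↭)
open import Data.List.Relation.Binary.Permutation.Propositional.Properties using (↭-length)
open import Data.Product using (∃; _×_; _,_; proj₁; proj₂)
open import Data.Sum using (_⊎_; inj₁; inj₂; [_,_])
open import Data.Empty using (⊥-elim)
open import Function.Bundles using (_⇔_; mk⇔)
open import Relation.Binary.Definitions using (DecidableEquality)
open import Relation.Nullary using (¬_; yes; no; does)
open import Relation.Binary.PropositionalEquality using (_≡_; refl; sym; trans; cong; cong₂; module ≡-Reasoning)

BoolFn : ℕ → Set
BoolFn n = Subset n → Bool

sec₀ sec₁ : ∀ {n} → BoolFn (suc n) → BoolFn n
sec₀ f S = f (outside ∷ S)
sec₁ f S = f (inside ∷ S)

_∪ᶠ_ _∩ᶠ_ : ∀ {n} → BoolFn n → BoolFn n → BoolFn n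
(f ∪ᶠ g) S = f S ∨ g S
(f ∩ᶠ g) S = f S ∧ g S

_⊑_ : ∀ {n} → BoolFn n → BoolFn n → Set
f ⊑ g = ∀ S → f S ≡ true → g S ≡ true

∨-introˡ : ∀ {a b} → a ≡ true → a ∨ b ≡ true
∨-introˡ refl = refl

∨-introʳ : ∀ {a b} → b ≡ true → a ∨ b ≡ true
∨-introʳ {a} refl = ∨-zeroʳ a

∨-elim : ∀ a {b} → a ∨ b ≡ true → a ≡ true ⊎ b ≡ true
∨-elim true  _ = inj₁ refl
∨-elim false e = inj₂ e

∧-intro : ∀ {a b} → a ≡ true → b ≡ true → a ∧ b ≡ true
∧-intro refl refl = refl

sec₀-mono : ∀ {n} {f g : BoolFn (suc n)} → f ⊑ g → sec₀ f ⊑ sec₀ g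
sec₀-mono f⊑g S = f⊑g (outside ∷ S)

sec₁-mono : ∀ {n} {f g : BoolFn (suc n)} → f ⊑ g → sec₁ f ⊑ sec₁ g
sec₁-mono f⊑g S = f⊑g (inside ∷ S)

∪ᶠ-mono : ∀ {n} {f f′ g g′ : BoolFn n} → f ⊑ f′ → g ⊑ g′ → (f ∪ᶠ g) ⊑ (f′ ∪ᶠ g′)
∪ᶠ-mono {f = f} f⊑f′ g⊑g′ S e =
  [ (λ fS → ∨-introˡ (f⊑f′ S fS)) , (λ gS → ∨-introʳ (g⊑g′ S gS)) ] (∨-elim (f S) e)

b2n : Bool → ℕ
b2n true  = 1
b2n false = 0

count : ∀ {n} → BoolFn n → ℕ
count {zero}  f = b2n (f [])
count {suc n} f = count (sec₀ f) + count (sec₁ f)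

count-mono : ∀ {n} {f g : BoolFn n} → f ⊑ g → count f ≤ count g
count-mono {zero} {f} f⊑g with f [] in fS
... | true rewrite f⊑g [] fS = ≤-refl
... | false = z≤n
count-mono {suc n} f⊑g = +-mono-≤ (count-mono (sec₀-mono f⊑g)) (count-mono (sec₁-mono f⊑g))

count-gap : ∀ {n} {f g : BoolFn n} → f ⊑ g → ∀ S → count f + b2n (g S ∧ not (f S)) ≤ count g
count-gap {zero} {f} {g} f⊑g [] with f [] in fS
... | true rewrite f⊑g [] fS = ≤-refl
... | false with g []
...   | true  = ≤-refl
...   | false = ≤-refl
count-gap {suc n} {f} {g} f⊑g (outside ∷ S) = begin
  count (sec₀ f) + count (sec₁ f) + b2n (sec₀ g S ∧ not (sec₀ f S))
    ≡⟨ swap₂₃ (count (sec₀ f)) (count (sec₁ f)) _ ⟩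
  count (sec₀ f) + b2n (sec₀ g S ∧ not (sec₀ f S)) + count (sec₁ f)
    ≤⟨ +-mono-≤ (count-gap (sec₀-mono f⊑g) S) (count-mono (sec₁-mono f⊑g)) ⟩
  count (sec₀ g) + count (sec₁ g) ∎
  where
  open ≤-Reasoning
  swap₂₃ : ∀ a b c → a + b + c ≡ a + c + b
  swap₂₃ = solve-∀
count-gap {suc n} {f} {g} f⊑g (inside ∷ S) = begin
  count (sec₀ f) + count (sec₁ f) + b2n (sec₁ g S ∧ not (sec₁ f S))
    ≡⟨ +-assoc (count (sec₀ f)) (count (sec₁ f)) _ ⟩
  count (sec₀ f) + (count (sec₁ f) + b2n (sec₁ g S ∧ not (sec₁ f S)))
    ≤⟨ +-mono-≤ (count-mono (sec₀-mono f⊑g)) (count-gap (sec₁-mono f⊑g) S) ⟩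
  count (sec₀ g) + count (sec₁ g) ∎
  where open ≤-Reasoning

count-modular : ∀ {n} (f g : BoolFn n) → count (f ∪ᶠ g) + count (f ∩ᶠ g) ≡ count f + count g
count-modular {zero} f g with f [] | g []
... | true  | true  = refl
... | true  | false = refl
... | false | true  = refl
... | false | false = refl
count-modular {suc n} f g = begin
  (∪₀ + ∪₁) + (∩₀ + ∩₁)                ≡⟨ interchange ∪₀ ∪₁ ∩₀ ∩₁ ⟩
  (∪₀ + ∩₀) + (∪₁ + ∩₁)                ≡⟨ cong₂ _+_ (count-modular (sec₀ f) (sec₀ g)) (count-modular (sec₁ f) (sec₁ g)) ⟩
  (f₀ + g₀) + (f₁ + g₁)                ≡⟨ interchange f₀ g₀ f₁ g₁ ⟩
  (f₀ + f₁) + (g₀ + g₁)                ∎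
  where
  open ≡-Reasoning
  interchange : ∀ a b c d → a + b + (c + d) ≡ a + c + (b + d)
  interchange = solve-∀
  ∪₀ ∪₁ ∩₀ ∩₁ f₀ f₁ g₀ g₁ : ℕ
  ∪₀ = count (sec₀ (f ∪ᶠ g))
  ∪₁ = count (sec₁ (f ∪ᶠ g))
  ∩₀ = count (sec₀ (f ∩ᶠ g))
  ∩₁ = count (sec₁ (f ∩ᶠ g))
  f₀ = count (sec₀ f)
  f₁ = count (sec₁ f)
  g₀ = count (sec₀ g)
  g₁ = count (sec₁ g)

-- A set avoiding the first coordinate is
-- shattered iff it is shattered by the projection sec₀ f ∪ sec₁ f; a set
-- containing it is shattered iff the rest is shattered by both sections.
shattered : ∀ {n} → BoolFn n → BoolFn n
shattered {zero}  f []            = f []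
shattered {suc n} f (outside ∷ S) = shattered (sec₀ f ∪ᶠ sec₁ f) S
shattered {suc n} f (inside ∷ S)  = shattered (sec₀ f) S ∧ shattered (sec₁ f) S

strongTrace : ∀ {n} → BoolFn n → BoolFn n
strongTrace {zero}  f []            = f []
strongTrace {suc n} f (outside ∷ S) = strongTrace (sec₀ f) S ∨ strongTrace (sec₁ f) S
strongTrace {suc n} f (inside ∷ S)  = strongTrace (sec₀ f ∩ᶠ sec₁ f) S

shattered-mono : ∀ {n} {f g : BoolFn n} → f ⊑ g → shattered f ⊑ shattered g
shattered-mono {zero}  f⊑g []            = f⊑g []
shattered-mono {suc n} f⊑g (outside ∷ S) =
  shattered-mono (∪ᶠ-mono (sec₀-mono f⊑g) (sec₁-mono f⊑g)) S
shattered-mono {suc n} f⊑g (inside ∷ S) e =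
  ∧-intro (shattered-mono (sec₀-mono f⊑g) S (∧-conicalˡ _ _ e))
          (shattered-mono (sec₁-mono f⊑g) S (∧-conicalʳ _ _ e))

shattered-∪ : ∀ {n} (f g : BoolFn n) → (shattered f ∪ᶠ shattered g) ⊑ shattered (f ∪ᶠ g)
shattered-∪ f g S e =
  [ shattered-mono (λ T → ∨-introˡ) S , shattered-mono (λ T → ∨-introʳ) S ] (∨-elim _ e)

shattered-∩ : ∀ {n} (f g : BoolFn n) → shattered (f ∩ᶠ g) ⊑ (shattered f ∩ᶠ shattered g)
shattered-∩ f g S e =
  ∧-intro (shattered-mono (λ T → ∧-conicalˡ _ _) S e) (shattered-mono (λ T → ∧-conicalʳ _ _) S e)

defect : ∀ {n} → BoolFn n → Subset n → ℕ
defect f S = b2n (shattered f S ∧ not (strongTrace f S))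

-- How a defect splits over the inductive step (pure Boolean facts): if the
-- left side is 1, one of the defects on the right is 1.  For outside ∷ S the
-- right-hand terms are the defects of S for the two sections and the gain in
-- Sh(f₀) ∪ Sh(f₁) ⊑ Sh(f₀ ∪ f₁); for inside ∷ S they are the defect of S for
-- f₀ ∩ f₁ and the gain in Sh(f₀ ∩ f₁) ⊑ Sh(f₀) ∩ Sh(f₁).
defect-split-outside : ∀ a x₀ y₀ x₁ y₁ →
  b2n (a ∧ not (y₀ ∨ y₁)) ≤ b2n (x₀ ∧ not y₀) + b2n (x₁ ∧ not y₁) + b2n (a ∧ not (x₀ ∨ x₁))
defect-split-outside false _     _     _     _     = z≤n
defect-split-outside true  _     true  _     _     = z≤n
defect-split-outside true  _     false _     true  = z≤n
defect-split-outside true  true  false _     false = s≤s z≤n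
defect-split-outside true  false false true  false = s≤s z≤n
defect-split-outside true  false false false false = s≤s z≤n

defect-split-inside : ∀ a b c → b2n (a ∧ not c) ≤ b2n (b ∧ not c) + b2n (a ∧ not b)
defect-split-inside false _     _     = z≤n
defect-split-inside true  _     true  = z≤n
defect-split-inside true  true  false = s≤s z≤n
defect-split-inside true  false false = s≤s z≤n

pajor : ∀ {n} (f : BoolFn n) S → count f + defect f S ≤ count (shattered f)
pajor {zero} f [] with f []
... | true  = ≤-refl
... | false = ≤-refl
pajor {suc n} f (outside ∷ S) = begin
  count f₀ + count f₁ + defect f (outside ∷ S)
    ≤⟨ +-monoʳ-≤ (count f₀ + count f₁) (defect-split-outside (shattered (f₀ ∪ᶠ f₁) S)
                                   (shattered f₀ S) (strongTrace f₀ S) (shattered f₁ S) (strongTrace f₁ S)) ⟩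
  count f₀ + count f₁ + (defect f₀ S + defect f₁ S + d)
    ≡⟨ regroup (count f₀) (count f₁) (defect f₀ S) (defect f₁ S) d ⟩
  (count f₀ + defect f₀ S) + (count f₁ + defect f₁ S) + d
    ≤⟨ +-monoˡ-≤ d (+-mono-≤ (pajor f₀ S) (pajor f₁ S)) ⟩
  count (shattered f₀) + count (shattered f₁) + d
    ≡⟨ cong (_+ d) (sym (count-modular (shattered f₀) (shattered f₁))) ⟩
  count (shattered f₀ ∪ᶠ shattered f₁) + count (shattered f₀ ∩ᶠ shattered f₁) + d
    ≡⟨ swap₂₃ (count (shattered f₀ ∪ᶠ shattered f₁)) _ d ⟩
  count (shattered f₀ ∪ᶠ shattered f₁) + d + count (shattered f₀ ∩ᶠ shattered f₁)
    ≤⟨ +-monoˡ-≤ _ (count-gap (shattered-∪ f₀ f₁) S) ⟩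
  count (shattered (f₀ ∪ᶠ f₁)) + count (shattered f₀ ∩ᶠ shattered f₁) ∎
  where
  open ≤-Reasoning
  f₀ f₁ : BoolFn n
  f₀ = sec₀ f
  f₁ = sec₁ f
  d : ℕ
  d = b2n (shattered (f₀ ∪ᶠ f₁) S ∧ not (shattered f₀ S ∨ shattered f₁ S))
  regroup : ∀ a b c d e → a + b + (c + d + e) ≡ a + c + (b + d) + e
  regroup = solve-∀
  swap₂₃ : ∀ a b c → a + b + c ≡ a + c + b
  swap₂₃ = solve-∀
pajor {suc n} f (inside ∷ S) = begin
  count f₀ + count f₁ + defect f (inside ∷ S)
    ≤⟨ +-monoʳ-≤ (count f₀ + count f₁) (defect-split-inside (shattered f₀ S ∧ shattered f₁ S)
                                  (shattered (f₀ ∩ᶠ f₁) S) (strongTrace (f₀ ∩ᶠ f₁) S)) ⟩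
  count f₀ + count f₁ + (defect (f₀ ∩ᶠ f₁) S + d)
    ≡⟨ cong (_+ (defect (f₀ ∩ᶠ f₁) S + d)) (sym (count-modular f₀ f₁)) ⟩
  count (f₀ ∪ᶠ f₁) + count (f₀ ∩ᶠ f₁) + (defect (f₀ ∩ᶠ f₁) S + d)
    ≡⟨ regroup (count (f₀ ∪ᶠ f₁)) (count (f₀ ∩ᶠ f₁)) (defect (f₀ ∩ᶠ f₁) S) d ⟩
  count (f₀ ∪ᶠ f₁) + (count (f₀ ∩ᶠ f₁) + defect (f₀ ∩ᶠ f₁) S + d)
    ≤⟨ +-mono-≤ (pajor-weak (f₀ ∪ᶠ f₁)) (+-monoˡ-≤ d (pajor (f₀ ∩ᶠ f₁) S)) ⟩
  count (shattered (f₀ ∪ᶠ f₁)) + (count (shattered (f₀ ∩ᶠ f₁)) + d)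
    ≤⟨ +-monoʳ-≤ (count (shattered (f₀ ∪ᶠ f₁))) (count-gap (shattered-∩ f₀ f₁) S) ⟩
  count (shattered (f₀ ∪ᶠ f₁)) + count (shattered f₀ ∩ᶠ shattered f₁) ∎
  where
  open ≤-Reasoning
  f₀ f₁ : BoolFn n
  f₀ = sec₀ f
  f₁ = sec₁ f
  d : ℕ
  d = b2n ((shattered f₀ S ∧ shattered f₁ S) ∧ not (shattered (f₀ ∩ᶠ f₁) S))
  regroup : ∀ a b c d → a + b + (c + d) ≡ a + (b + c + d)
  regroup = solve-∀
  pajor-weak : (g : BoolFn n) → count g ≤ count (shattered g)
  pajor-weak g = ≤-trans (m≤m+n (count g) (defect g S)) (pajor g S)

balanced⇒strongTrace : ∀ {n} (f : BoolFn n) → count (shattered f) ≡ count f →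
  shattered f ⊑ strongTrace f
balanced⇒strongTrace f balanced S shS with strongTrace f S in stS
... | true  = refl
... | false = ⊥-elim (m+1+n≰m (count f) (begin
  count f + 1                  ≡⟨ cong (count f +_) (sym (defect-one shS stS)) ⟩
  count f + defect f S         ≤⟨ pajor f S ⟩
  count (shattered f)          ≡⟨ balanced ⟩
  count f                      ∎))
  where
  open ≤-Reasoning
  defect-one : ∀ {a b} → a ≡ true → b ≡ false → b2n (a ∧ not b) ≡ 1
  defect-one refl refl = refl

strongTrace-witness : ∀ {n} (f : BoolFn n) S → strongTrace f S ≡ true →
  ∃ λ T → f T ≡ true × f (T ∪ S) ≡ true × ∣ T ∪ S ∣ ≡ ∣ T ∣ + ∣ S ∣
strongTrace-witness {zero} f [] e = [] , e , e , refl
strongTrace-witness {suc n} f (outside ∷ S) e with strongTrace (sec₀ f) S in st₀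
... | true with strongTrace-witness (sec₀ f) S st₀
...   | T , bottom , top , size = outside ∷ T , bottom , top , size
strongTrace-witness {suc n} f (outside ∷ S) e | false with strongTrace-witness (sec₁ f) S e
...   | T , bottom , top , size = inside ∷ T , bottom , top , cong suc size
strongTrace-witness {suc n} f (inside ∷ S) e with strongTrace-witness (sec₀ f ∩ᶠ sec₁ f) S e
... | T , bottom , top , size =
  outside ∷ T , ∧-conicalˡ _ _ bottom , ∧-conicalʳ _ _ top , trans (cong suc size) (sym (+-suc ∣ T ∣ ∣ S ∣))

ShattersFn : ∀ {n} → BoolFn n → Subset n → Set
ShattersFn f S = ∀ T → T ⊆ S → ∃ λ X → f X ≡ true × X ∩ S ≡ T

inside⊈outside : ∀ {n} {T S : Subset n} → ¬ (inside ∷ T ⊆ outside ∷ S)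
inside⊈outside T⊆S with T⊆S here
... | ()

shatters⇒shattered : ∀ {n} (f : BoolFn n) S → ShattersFn f S → shattered f S ≡ true
shatters⇒shattered {zero} f [] sh with sh [] (λ x → x)
... | [] , fX , _ = fX
shatters⇒shattered {suc n} f (outside ∷ S) sh = shatters⇒shattered _ S projected
  where
  projected : ShattersFn (sec₀ f ∪ᶠ sec₁ f) S
  projected T T⊆S with sh (outside ∷ T) (out⊆ T⊆S)
  ... | outside ∷ X , fX , trace = X , ∨-introˡ fX , ∷-injectiveʳ trace
  ... | inside  ∷ X , fX , trace = X , ∨-introʳ fX , ∷-injectiveʳ trace
shatters⇒shattered {suc n} f (inside ∷ S) sh =
  ∧-intro (shatters⇒shattered _ S section₀) (shatters⇒shattered _ S section₁)
  where
  section₀ : ShattersFn (sec₀ f) S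
  section₀ T T⊆S with sh (outside ∷ T) (out⊆ T⊆S)
  ... | outside ∷ X , fX , trace = X , fX , ∷-injectiveʳ trace
  section₁ : ShattersFn (sec₁ f) S
  section₁ T T⊆S with sh (inside ∷ T) (in⊆in T⊆S)
  ... | inside ∷ X , fX , trace = X , fX , ∷-injectiveʳ trace

shattered⇒shatters : ∀ {n} (f : BoolFn n) S → shattered f S ≡ true → ShattersFn f S
shattered⇒shatters {zero} f [] e [] _ = [] , e , refl
shattered⇒shatters {suc n} f (outside ∷ S) e (inside ∷ T) T⊆S = ⊥-elim (inside⊈outside T⊆S)
shattered⇒shatters {suc n} f (outside ∷ S) e (outside ∷ T) T⊆S
  with shattered⇒shatters _ S e T (drop-∷-⊆ T⊆S)
... | X , fX , trace with f (outside ∷ X) in f₀X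
...   | true  = outside ∷ X , f₀X , cong (outside ∷_) trace
...   | false = inside ∷ X , fX , cong (outside ∷_) trace
shattered⇒shatters {suc n} f (inside ∷ S) e (outside ∷ T) T⊆S
  with shattered⇒shatters (sec₀ f) S (∧-conicalˡ _ _ e) T (drop-∷-⊆ T⊆S)
... | X , fX , trace = outside ∷ X , fX , cong (outside ∷_) trace
shattered⇒shatters {suc n} f (inside ∷ S) e (inside ∷ T) T⊆S
  with shattered⇒shatters (sec₁ f) S (∧-conicalʳ _ _ e) T (drop-∷-⊆ T⊆S)
... | X , fX , trace = inside ∷ X , fX , cong (inside ∷_) trace

points : ∀ {n} → BoolFn n → List (Subset n)
points {zero}  f = if f [] then [] ∷ [] else []
points {suc n} f = map (outside ∷_) (points (sec₀ f)) ++ map (inside ∷_) (points (sec₁ f))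

points-length : ∀ {n} (f : BoolFn n) → length (points f) ≡ count f
points-length {zero} f with f []
... | true  = refl
... | false = refl
points-length {suc n} f = begin
  length (map (outside ∷_) (points (sec₀ f)) ++ map (inside ∷_) (points (sec₁ f)))
    ≡⟨ length-++ (map (outside ∷_) (points (sec₀ f))) ⟩
  length (map (outside ∷_) (points (sec₀ f))) + length (map (inside ∷_) (points (sec₁ f)))
    ≡⟨ cong₂ _+_ (length-map (outside ∷_) (points (sec₀ f))) (length-map (inside ∷_) (points (sec₁ f))) ⟩
  length (points (sec₀ f)) + length (points (sec₁ f))
    ≡⟨ cong₂ _+_ (points-length (sec₀ f)) (points-length (sec₁ f)) ⟩
  count (sec₀ f) + count (sec₁ f) ∎
  where open ≡-Reasoning

points-unique : ∀ {n} (f : BoolFn n) → Unique (points f)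
points-unique {zero} f with f []
... | true  = All.[] ∷ []
... | false = []
points-unique {suc n} f =
  ++⁺ (map⁺ ∷-injectiveʳ (points-unique (sec₀ f))) (map⁺ ∷-injectiveʳ (points-unique (sec₁ f))) different-heads
  where
  different-heads : ∀ {S} → ¬ (S ∈ map (outside ∷_) (points (sec₀ f)) × S ∈ map (inside ∷_) (points (sec₁ f)))
  different-heads (S∈₀ , S∈₁) with ∈-map⁻ (outside ∷_) S∈₀ | ∈-map⁻ (inside ∷_) S∈₁
  ... | _ , _ , refl | _ , _ , ()

points-complete : ∀ {n} (f : BoolFn n) S → f S ≡ true → S ∈ points f
points-complete {zero}  f [] e rewrite e = here refl
points-complete {suc n} f (outside ∷ S) e = ∈-++⁺ˡ (∈-map⁺ (outside ∷_) (points-complete (sec₀ f) S e))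
points-complete {suc n} f (inside ∷ S) e =
  ∈-++⁺ʳ (map (outside ∷_) (points (sec₀ f))) (∈-map⁺ (inside ∷_) (points-complete (sec₁ f) S e))

points-sound : ∀ {n} (f : BoolFn n) S → S ∈ points f → f S ≡ true
points-sound {zero} f [] S∈ with f []
points-sound {zero} f [] S∈ | true = refl
points-sound {zero} f [] () | false
points-sound {suc n} f S S∈ with ∈-++⁻ (map (outside ∷_) (points (sec₀ f))) S∈
... | inj₁ S∈₀ with ∈-map⁻ (outside ∷_) S∈₀
...   | T , T∈ , refl = points-sound (sec₀ f) T T∈
points-sound {suc n} f S S∈ | inj₂ S∈₁ with ∈-map⁻ (inside ∷_) S∈₁
...   | T , T∈ , refl = points-sound (sec₁ f) T T∈

enumeration-length : ∀ {n} (f : BoolFn n) (L : List (Subset n)) → Unique L →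
  (∀ S → S ∈ L → f S ≡ true) → (∀ S → f S ≡ true → S ∈ L) → length L ≡ count f
enumeration-length f L unique sound complete =
  trans (↭-length (∼bag⇒↭ (unique∧set⇒bag unique (points-unique f) same-members))) (points-length f)
  where
  same-members : ∀ {S} → S ∈ L ⇔ S ∈ points f
  same-members {S} = mk⇔ (λ S∈L → points-complete f S (sound S S∈L)) (λ S∈ → complete S (points-sound f S S∈))

module _ {n : ℕ} where
  _≟ˢ_ : DecidableEquality (Subset n)
  _≟ˢ_ = ≡-dec _≟ᵇ_

  open DecMembership _≟ˢ_ using (_∈?_)

  indicator : Family n → BoolFn n
  indicator 𝓕 X = does (X ∈? members 𝓕)

  indicator-complete : ∀ (𝓕 : Family n) X → X ∈ members 𝓕 → indicator 𝓕 X ≡ true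
  indicator-complete 𝓕 X X∈ with X ∈? members 𝓕
  ... | yes _  = refl
  ... | no X∉ = ⊥-elim (X∉ X∈)

  indicator-sound : ∀ (𝓕 : Family n) X → indicator 𝓕 X ≡ true → X ∈ members 𝓕
  indicator-sound 𝓕 X e with X ∈? members 𝓕
  ... | yes X∈ = X∈

shatters⇒shattered-indicator : ∀ {n} (𝓕 : Family n) S → Shatters 𝓕 S → shattered (indicator 𝓕) S ≡ true
shatters⇒shattered-indicator 𝓕 S sh = shatters⇒shattered (indicator 𝓕) S λ T T⊆S →
  let X , X∈ , trace = sh T T⊆S in X , indicator-complete 𝓕 X X∈ , trace

shattered-indicator⇒shatters : ∀ {n} (𝓕 : Family n) S → shattered (indicator 𝓕) S ≡ true → Shatters 𝓕 S
shattered-indicator⇒shatters 𝓕 S e T T⊆S =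
  let X , fX , trace = shattered⇒shatters (indicator 𝓕) S e T T⊆S in X , indicator-sound 𝓕 X fX , trace

extremal-strongTrace : ∀ {n} (𝓕 : Family n) → SExtremal 𝓕 → ∀ S → Shatters 𝓕 S →
  ∃ λ T → T ∈ members 𝓕 × (T ∪ S) ∈ members 𝓕 × ∣ T ∪ S ∣ ≡ ∣ T ∣ + ∣ S ∣
extremal-strongTrace 𝓕 (L , (unique , enumerates) , |L|≡|𝓕|) S shS =
  let T , bottom , top , size = strongTrace-witness f S
        (balanced⇒strongTrace f balanced S (shatters⇒shattered-indicator 𝓕 S shS))
  in T , indicator-sound 𝓕 T bottom , indicator-sound 𝓕 (T ∪ S) top , size
  where
  f : BoolFn _
  f = indicator 𝓕
  balanced : count (shattered f) ≡ count f
  balanced = begin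
    count (shattered f) ≡⟨ sym (enumeration-length (shattered f) L unique
                              (λ R R∈L → shatters⇒shattered-indicator 𝓕 R (proj₁ (enumerates R) R∈L))
                              (λ R e → proj₂ (enumerates R) (shattered-indicator⇒shatters 𝓕 R e))) ⟩
    length L            ≡⟨ |L|≡|𝓕| ⟩
    card 𝓕              ≡⟨ enumeration-length f (members 𝓕) (distinct 𝓕) (indicator-complete 𝓕) (indicator-sound 𝓕) ⟩
    count f             ∎
    where open ≡-Reasoning

layer-sizes : ∀ {n k} (𝓕 : Family n) → InTwoLayers 𝓕 k → ∀ {A B} →
  A ∈ members 𝓕 → B ∈ members 𝓕 → ∣ B ∣ ≤ suc ∣ A ∣
layer-sizes {k = k} 𝓕 layers {A} {B} A∈ B∈ = ≤-trans (at-most-k (layers B B∈)) (at-least-k-1 (layers A A∈))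
  where
  at-most-k : ∀ {x} → x ≡ k ⊎ suc x ≡ k → x ≤ k
  at-most-k (inj₁ refl) = ≤-refl
  at-most-k (inj₂ refl) = n≤1+n _
  at-least-k-1 : ∀ {x} → x ≡ k ⊎ suc x ≡ k → k ≤ suc x
  at-least-k-1 (inj₁ refl) = n≤1+n _
  at-least-k-1 (inj₂ refl) = ≤-refl

mainTheorem4 : ∀ (n k : ℕ) → 1 ≤ k → k ≤ n → (𝓕 : Family n) →
    InTwoLayers 𝓕 k → SExtremal 𝓕 → VCdim≤ 𝓕 1
mainTheorem4 n k _ _ 𝓕 layers extremal S shS =
  let T , T∈ , T∪S∈ , size = extremal-strongTrace 𝓕 extremal S shS
  in +-cancelˡ-≤ ∣ T ∣ ∣ S ∣ 1 (begin
    ∣ T ∣ + ∣ S ∣ ≡⟨ sym size ⟩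
    ∣ T ∪ S ∣     ≤⟨ layer-sizes 𝓕 layers T∈ T∪S∈ ⟩
    suc ∣ T ∣     ≡⟨ +-comm 1 ∣ T ∣ ⟩
    ∣ T ∣ + 1     ∎)
  where open ≤-Reasoning
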